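{- Let $L$ be a list of finite sets, $F_t$, $F_c$, $F'$ finite families of finite sets, $X$ a finite set and $w$ a function to $\mathbb{N}$. Suppose (i) $\mathrm{ssn}_L(L,F_t,F_c)=\mathrm{false}$; (ii) $s(A)<0$ for every entry $A$ of $L$; (iii) every $A\in F'\setminus F_t$ with $s(A)<0$ is an entry of $L$; (iv) $F_t\subseteq F'$; (v) $F'$ is union closed for $F_c$. Then $\sum_{A\in F'}s(A)\ge 0$.
   Context: $w(A)=\sum_{a\in A}w(a)$; $s(A)=2w(A)-w(X)$ (an integer) and $s(G)=\sum_{A\in G}s(A)$ for a family $G$. A family $G$ is union closed for $G_c$ if $A\cup B\in G$ for all $A,B\in G$ and $A\cup B\in G$ for all $A\in G$, $B\in G_c$. For a family $G_c$, a set $h$ and a family $G$, $\mathrm{ic}_{G_c}(h,G)=G\cup\{h\}\cup\{h\cup B:B\in G\}\cup\{h\cup B:B\in G_c\}$. The boolean function $\mathrm{ssn}_L(L,F_t,G_c)$ (with $w,X$ fixed) is defined by recursion on the list: $\mathrm{ssn}_L([\,],F_t,G_c)=(s(F_t)<0)$; for a list $h\#t$ with head $h$ and tail $t$: if $s(F_t)+\sum_{A\in\mathrm{set}(h\#t)}s(A)\ge 0$ then false; else if $\mathrm{ssn}_L(t,F_t,G_c)$ then true; else if $h\in F_t$ then false; else $\mathrm{ssn}_L(t,\mathrm{ic}_{G_c}(h,F_t),G_c)$. -}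

module Defs where

open import Data.Bool using (Bool; true; false; if_then_else_; _∨_)
open import Data.Nat using (ℕ; zero; suc)
open import Data.Integer as ℤ using (ℤ; +_; _-_; _*_; _<?_; _≤?_)
open import Data.Fin using (Fin)
open import Data.Fin.Subset using (Subset; _∪_)
open import Data.Fin.Subset.Properties using (_∈?_)
import Data.Vec.Properties as VP
import Data.Bool as B
open import Data.List using (List; []; _∷_; map; _++_; foldr)
open import Data.Bool.ListAction using (any)
open import Data.Vec using ([]; _∷_)
open import Relation.Nullary.Decidable using (⌊_⌋)
open import Relation.Binary.PropositionalEquality using (_≡_)
open import Relation.Binary.Definitions using (DecidableEquality)
open import Data.Product using (_×_)

_≟_ : {n : ℕ} → DecidableEquality (Subset n)
_≟_ = VP.≡-dec B._≟_

-- Elements are drawn from Fin n; a finite set is a Subset n.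
-- A (finite) family of sets is given by its characteristic function.
Family : ℕ → Set
Family n = Subset n → Bool

-- all subsets of Fin n (each exactly once)
allSubsets : (n : ℕ) → List (Subset n)
allSubsets zero = [] ∷ []
allSubsets (suc n) = map (true ∷_) (allSubsets n) ++ map (false ∷_) (allSubsets n)

allFin : (n : ℕ) → List (Fin n)
allFin n = Data.List.allFin n

module _ {n : ℕ} (w : Fin n → ℕ) (X : Subset n) where

  wt : Subset n → ℕ
  wt A = foldr (λ a acc → if ⌊ a ∈? A ⌋ then w a Data.Nat.+ acc else acc) 0 (allFin n)

  s : Subset n → ℤ
  s A = (+ 2) * (+ wt A) - + wt X

  sF : Family n → ℤ
  sF G = foldr (λ A acc → if G A then s A ℤ.+ acc else acc) (+ 0) (allSubsets n)

  ic : Family n → Subset n → Family n → Family n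
  ic Gc h G C = G C ∨ (⌊ C ≟ h ⌋
              ∨ (any (λ B → G B B.∧ ⌊ C ≟ (h ∪ B) ⌋) (allSubsets n)
              ∨ any (λ B → Gc B B.∧ ⌊ C ≟ (h ∪ B) ⌋) (allSubsets n)))

  setOf : List (Subset n) → Family n
  setOf L C = any (λ A → ⌊ C ≟ A ⌋) L

  ssnL : List (Subset n) → Family n → Family n → Bool
  ssnL [] Ft Gc = ⌊ sF Ft <? + 0 ⌋
  ssnL (h ∷ t) Ft Gc =
    if ⌊ + 0 ≤? sF Ft ℤ.+ sF (setOf (h ∷ t)) ⌋ then false
    else if ssnL t Ft Gc then true
    else if Ft h then false
    else ssnL t (ic Gc h Ft) Gc

UnionClosedFor : {n : ℕ} → Family n → Family n → Set
UnionClosedFor {n} G Gc =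
  (∀ (A B : Subset n) → G A ≡ true → G B ≡ true → G (A ∪ B) ≡ true) ×
  (∀ (A B : Subset n) → G A ≡ true → Gc B ≡ true → G (A ∪ B) ≡ true)

-- The proof is by induction on L, generalising over Ft, and rests on one
-- counting fact (sumOver-split): if P ⊆ R, every member of Q has negative
-- weight and every negative member of R ∖ P lies in Q, then
-- s(P) + s(Q) ≤ s(R).  Applied with Q = set(L) it gives family-bound.
--   * L = []      : ssnL returned false, so s(Ft) ≥ 0, and s(Ft) ≤ s(F').
--   * L = h ∷ t   : either s(Ft) + s(set(h ∷ t)) ≥ 0 and family-bound finishes,
--     or ssnL t Ft Fc is false and we recurse on t — with Ft itself when h is
--     not a "missing" set of F' (Ft h or ¬ F' h), and otherwise with
--     ic(h, Ft), which stays inside F' by union closure (ic-sub).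

module Submission where

open import Defs
open import Data.Bool using (Bool; true; false; if_then_else_; _∨_; _∧_)
open import Data.Bool.Properties using (T-≡; T-∧; ∨-zeroʳ)
open import Data.Nat using (ℕ)
open import Data.Integer using (ℤ; +_; _<_; _≤_)
import Data.Integer as ℤ
import Data.Integer.Properties as ℤP
open import Algebra.Properties.CommutativeSemigroup ℤP.+-commutativeSemigroup
  using (interchange)
open import Data.Fin using (Fin)
open import Data.Fin.Subset using (Subset; _∪_)
open import Data.List using (List; []; _∷_; foldr)
open import Data.List.Relation.Unary.All as All using (All)
open import Data.List.Relation.Unary.Any as Any using (here; there)
open import Data.List.Relation.Unary.Any.Properties using (any⁺; any⁻)
open import Data.List.Membership.Propositional using (_∈_)
open import Data.Bool.ListAction using (any)
open import Relation.Binary.PropositionalEquality using (_≡_; refl; sym; trans; cong; cong₂)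
open import Relation.Nullary using (yes; no; contradiction)
open import Relation.Nullary.Decidable using (⌊_⌋; toWitness; fromWitness)
open import Data.Product using (_×_; _,_; ∃)
open import Data.Sum using (_⊎_; inj₁; inj₂)
open import Function using (id)
open import Function.Bundles using (Equivalence)

open Equivalence using (to; from)

∨-true : ∀ a b → a ∨ b ≡ true → a ≡ true ⊎ b ≡ true
∨-true true  _ _ = inj₁ refl
∨-true false _ e = inj₂ e

module WeightedSums {A : Set} (f : A → ℤ) where

  term : (A → Bool) → A → ℤ
  term G x = if G x then f x else + 0

  -- Σ_{x ∈ xs, G x} f(x); for xs = allSubsets n and f = s this is sF.
  sumOver : (A → Bool) → List A → ℤ
  sumOver G = foldr (λ x acc → if G x then f x ℤ.+ acc else acc) (+ 0)

  sumOver-∷ : ∀ G x xs → sumOver G (x ∷ xs) ≡ term G x ℤ.+ sumOver G xs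
  sumOver-∷ G x xs with G x
  ... | true  = refl
  ... | false = sym (ℤP.+-identityˡ _)

  sumOver-none : ∀ xs → sumOver (λ _ → false) xs ≡ + 0
  sumOver-none []       = refl
  sumOver-none (_ ∷ xs) = sumOver-none xs

  -- Single-element form of sumOver-split: membership of x in P, Q, R
  -- constrained as there, the contributions of x satisfy the inequality.
  term-split : ∀ p q r (v : ℤ) → (p ≡ true → r ≡ true) → (q ≡ true → v < + 0) →
    (r ≡ true → p ≡ false → v < + 0 → q ≡ true) →
    (if p then v else + 0) ℤ.+ (if q then v else + 0) ≤ (if r then v else + 0)
  term-split true  _     false v P⊆R _ _ with () ← P⊆R refl
  term-split true  true  true  v _ Q⁻ _ = ℤP.≤-trans
    (ℤP.+-monoʳ-≤ v (ℤP.<⇒≤ (Q⁻ refl))) (ℤP.≤-reflexive (ℤP.+-identityʳ v))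
  term-split true  false true  v _ _ _ = ℤP.≤-reflexive (ℤP.+-identityʳ v)
  term-split false true  true  v _ _ _ = ℤP.≤-reflexive (ℤP.+-identityˡ v)
  term-split false true  false v _ Q⁻ _ =
    ℤP.≤-trans (ℤP.≤-reflexive (ℤP.+-identityˡ v)) (ℤP.<⇒≤ (Q⁻ refl))
  term-split false false false v _ _ _ = ℤP.≤-refl
  term-split false false true  v _ _ missing with v ℤ.<? + 0
  ... | yes v⁻ with () ← missing refl refl v⁻
  ... | no  v≮0 = ℤP.≮⇒≥ v≮0

  sumOver-split : ∀ (P Q R : A → Bool) →
    (∀ x → P x ≡ true → R x ≡ true) → (∀ x → Q x ≡ true → f x < + 0) →
    (∀ x → R x ≡ true → P x ≡ false → f x < + 0 → Q x ≡ true) →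
    ∀ xs → sumOver P xs ℤ.+ sumOver Q xs ≤ sumOver R xs
  sumOver-split P Q R P⊆R Q⁻ missing [] = ℤP.≤-refl
  sumOver-split P Q R P⊆R Q⁻ missing (x ∷ xs) = begin
    sumOver P (x ∷ xs) ℤ.+ sumOver Q (x ∷ xs)
      ≡⟨ cong₂ ℤ._+_ (sumOver-∷ P x xs) (sumOver-∷ Q x xs) ⟩
    (term P x ℤ.+ sumOver P xs) ℤ.+ (term Q x ℤ.+ sumOver Q xs)
      ≡⟨ interchange (term P x) (sumOver P xs) (term Q x) (sumOver Q xs) ⟩
    (term P x ℤ.+ term Q x) ℤ.+ (sumOver P xs ℤ.+ sumOver Q xs)
      ≤⟨ ℤP.+-mono-≤
           (term-split (P x) (Q x) (R x) (f x) (P⊆R x) (Q⁻ x) (missing x))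
           (sumOver-split P Q R P⊆R Q⁻ missing xs) ⟩
    term R x ℤ.+ sumOver R xs
      ≡⟨ sym (sumOver-∷ R x xs) ⟩
    sumOver R (x ∷ xs) ∎
    where
    open ℤP.≤-Reasoning

module _ {n : ℕ} (w : Fin n → ℕ) (X : Subset n) where

  open WeightedSums (s w X)

  _⊆ᶠ_ : Family n → Family n → Set
  G ⊆ᶠ H = ∀ A → G A ≡ true → H A ≡ true

  MissingIn : List (Subset n) → Family n → Family n → Set
  MissingIn L G F' = ∀ A → F' A ≡ true → G A ≡ false → s w X A < + 0 → A ∈ L

  setOf-∈ : ∀ {A} L → A ∈ L → setOf w X L A ≡ true
  setOf-∈ {A} L A∈L =
    to T-≡ (any⁺ _ (Any.map (λ { refl → fromWitness {a? = A ≟ A} refl }) A∈L))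

  setOf-neg : ∀ L → All (λ A → s w X A < + 0) L →
    ∀ C → setOf w X L C ≡ true → s w X C < + 0
  setOf-neg L L⁻ C C∈L = All.lookup L⁻
    (Any.map (λ {A} t → toWitness {a? = C ≟ A} t) (any⁻ _ L (from T-≡ C∈L)))

  family-bound : ∀ L (Ft F' : Family n) → Ft ⊆ᶠ F' →
    All (λ A → s w X A < + 0) L → MissingIn L Ft F' →
    sF w X Ft ℤ.+ sF w X (setOf w X L) ≤ sF w X F'
  family-bound L Ft F' Ft⊆F' L⁻ missing =
    sumOver-split Ft (setOf w X L) F' Ft⊆F' (setOf-neg L L⁻)
      (λ C F'C FtC C⁻ → setOf-∈ L (missing C F'C FtC C⁻)) (allSubsets n)

  sF-setOf-[] : sF w X (setOf w X []) ≡ + 0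
  sF-setOf-[] = sumOver-none (allSubsets n)

  missing-tail : ∀ {h t} {G G' F' : Family n} → MissingIn (h ∷ t) G F' →
    G ⊆ᶠ G' → (G' h ≡ true ⊎ F' h ≡ false) → MissingIn t G' F'
  missing-tail {G = G} missing G⊆G' h-present A F'A G'A A⁻ with G A in GA
  ... | true  with () ← trans (sym (G⊆G' A GA)) G'A
  ... | false with missing A F'A GA A⁻ | h-present
  ...   | here refl | inj₁ G'h with () ← trans (sym G'h) G'A
  ...   | here refl | inj₂ F'h with () ← trans (sym F'A) F'h
  ...   | there A∈t | _ = A∈t

  union-witness : ∀ (G : Family n) h C →
    any (λ B → G B ∧ ⌊ C ≟ (h ∪ B) ⌋) (allSubsets n) ≡ true →
    ∃ λ B → G B ≡ true × C ≡ h ∪ B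
  union-witness G h C found with Any.satisfied (any⁻ _ (allSubsets n) (from T-≡ found))
  ... | B , GB∧C≡h∪B with to T-∧ GB∧C≡h∪B
  ...   | GB , C≡h∪B = B , to T-≡ GB , toWitness {a? = C ≟ (h ∪ B)} C≡h∪B

  ic-extends : ∀ Gc h (G : Family n) → G ⊆ᶠ ic w X Gc h G
  ic-extends Gc h G A GA rewrite GA = refl

  ic-self : ∀ Gc h (G : Family n) → ic w X Gc h G h ≡ true
  ic-self Gc h G with h ≟ h
  ... | yes _   = ∨-zeroʳ (G h)
  ... | no  h≢h = contradiction refl h≢h

  ic-sub : ∀ {Gc F' : Family n} {G h} → UnionClosedFor F' Gc → F' h ≡ true →
    G ⊆ᶠ F' → ic w X Gc h G ⊆ᶠ F'
  ic-sub {Gc = Gc} {G = G} {h = h} (closed , closedFor) F'h G⊆F' C C∈ic with G C in GC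
  ... | true  = G⊆F' C GC
  ... | false with C ≟ h
  ...   | yes refl = F'h
  ...   | no  _ with ∨-true _ _ C∈ic
  ...     | inj₁ fromG  with B , GB , refl ← union-witness G h C fromG =
    closed h B F'h (G⊆F' B GB)
  ...     | inj₂ fromGc with B , GcB , refl ← union-witness Gc h C fromGc =
    closedFor h B F'h GcB

  ssnL-nil : ∀ (Ft Gc : Family n) → ssnL w X [] Ft Gc ≡ false → + 0 ≤ sF w X Ft
  ssnL-nil Ft Gc e with sF w X Ft ℤ.<? + 0
  ... | no Ft≮0 = ℤP.≮⇒≥ Ft≮0

  ssnL-cons : ∀ h t (Ft Gc : Family n) → ssnL w X (h ∷ t) Ft Gc ≡ false →
    + 0 ≤ sF w X Ft ℤ.+ sF w X (setOf w X (h ∷ t))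
    ⊎ (ssnL w X t Ft Gc ≡ false × (Ft h ≡ true ⊎ ssnL w X t (ic w X Gc h Ft) Gc ≡ false))
  ssnL-cons h t Ft Gc e with + 0 ℤ.≤? sF w X Ft ℤ.+ sF w X (setOf w X (h ∷ t))
  ... | yes bound = inj₁ bound
  ... | no  _ with ssnL w X t Ft Gc | Ft h
  ...   | false | true  = inj₂ (refl , inj₁ refl)
  ...   | false | false = inj₂ (refl , inj₂ e)

lemma5 : {n : ℕ} (w : Fin n → ℕ) (X : Subset n) (L : List (Subset n))
    (Ft Fc F' : Family n) →
    ssnL w X L Ft Fc ≡ false →
    All (λ A → s w X A < + 0) L →
    (∀ (A : Subset n) → F' A ≡ true → Ft A ≡ false → s w X A < + 0 → A ∈ L) →
    (∀ (A : Subset n) → Ft A ≡ true → F' A ≡ true) →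
    UnionClosedFor F' Fc →
    + 0 ≤ sF w X F'
lemma5 w X [] Ft Fc F' e L⁻ missing Ft⊆F' uc = begin
  + 0                                 ≤⟨ ssnL-nil w X Ft Fc e ⟩
  sF w X Ft                           ≡⟨ sym (ℤP.+-identityʳ _) ⟩
  sF w X Ft ℤ.+ + 0                   ≡⟨ cong (ℤ._+_ (sF w X Ft)) (sym (sF-setOf-[] w X)) ⟩
  sF w X Ft ℤ.+ sF w X (setOf w X []) ≤⟨ family-bound w X [] Ft F' Ft⊆F' L⁻ missing ⟩
  sF w X F'                           ∎
  where open ℤP.≤-Reasoning
lemma5 w X (h ∷ t) Ft Fc F' e L⁻ missing Ft⊆F' uc with ssnL-cons w X h t Ft Fc e
... | inj₁ bound = ℤP.≤-trans bound (family-bound w X (h ∷ t) Ft F' Ft⊆F' L⁻ missing)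
... | inj₂ (e-t , inj₁ Ft-h) =
  lemma5 w X t Ft Fc F' e-t (All.tail L⁻)
    (missing-tail w X missing (λ _ → id) (inj₁ Ft-h)) Ft⊆F' uc
... | inj₂ (e-t , inj₂ e-ic) with F' h in F'h
...   | false = lemma5 w X t Ft Fc F' e-t (All.tail L⁻)
                  (missing-tail w X missing (λ _ → id) (inj₂ F'h)) Ft⊆F' uc
...   | true  = lemma5 w X t (ic w X Fc h Ft) Fc F' e-ic (All.tail L⁻)
                  (missing-tail w X missing (ic-extends w X Fc h Ft) (inj₁ (ic-self w X Fc h Ft)))
                  (ic-sub w X uc F'h Ft⊆F') uc
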